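{- Let $n$ be an even positive integer. For every connected graph $G=(V,E)$ without a matching of size $n/2$ there is a partition $V=S\cup Q\cup I$ of the vertex set (parts possibly empty) such that (1) $|Q|+2|S|=\min\{v(G),n-1\}$; (2) $I$ is an independent set, and if $v(G)\leq n-1$ then $I=\emptyset$; (3) every vertex in $Q$ has at most one neighbor in $I$; (4) every vertex in $I$ has degree less than $n/2$.
   Context: Graphs are finite and simple; $v(G)$ is the number of vertices. The size of a matching is its number of edges. -}

module Defs where

open import Data.Nat using (ℕ; zero; suc; _+_)
open import Data.Fin using (Fin)
open import Data.Bool using (Bool; true; false; if_then_else_)
open import Data.Sum using (_⊎_; [_,_])
open import Data.Product using (Σ; _×_)
open import Data.List using (List; length; filter; allFin)
open import Relation.Binary.PropositionalEquality using (_≡_)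
open import Relation.Nullary using (¬_)
open import Relation.Binary.Construct.Closure.ReflexiveTransitive using (Star)
open import Function.Definitions using (Injective)

record Graph (m : ℕ) : Set where
  field
    adj     : Fin m → Fin m → Bool
    symm    : ∀ x y → adj x y ≡ adj y x
    irrefl  : ∀ x → adj x x ≡ false

open Graph public

v : ∀ {m} → Graph m → ℕ
v {m} _ = m

Adj : ∀ {m} → Graph m → Fin m → Fin m → Set
Adj G x y = adj G x y ≡ true

count : ∀ {m} → (Fin m → Bool) → ℕ
count {m} p = length (filter (λ x → p x Data.Bool.≟ true) (allFin m))

deg : ∀ {m} → Graph m → Fin m → ℕ
deg G x = count (adj G x)

Connected : ∀ {m} → Graph m → Set
Connected {m} G = ∀ (x y : Fin m) → Star (Adj G) x y

-- a matching of size k: k edges {u i, v i}, all 2k endpoints pairwise distinct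
record Matching {m} (G : Graph m) (k : ℕ) : Set where
  field
    left  : Fin k → Fin m
    right : Fin k → Fin m
    isEdge : ∀ i → Adj G (left i) (right i)
    disjoint : Injective _≡_ _≡_ [ left , right ]

data Part : Set where
  S Q I : Part

isPart : Part → Part → Bool
isPart S S = true
isPart Q Q = true
isPart I I = true
isPart _ _ = false

module Submission where

-- Fix k and a vertex set W such that G[W] has no matching of size k+1.
-- We construct a "barrier" for (k, W): sets Sep and Ind ⊆ W∖Sep with Ind independent,
-- every vertex of W∖Sep having at most one neighbour in Ind, every vertex of Ind
-- having at most k neighbours in W, and |W| + |Sep| ≤ 2k+1 + |Ind|.  The
-- construction is by induction on k:
--   * if some v ∈ W leaves G[W−v] without a k-matching, recurse on (k−1, W−v) and
--     put v into Sep;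
--   * otherwise G[W] is critical (every G[W−v] has a k-matching).  Take a
--     k-matching M₀ of G[W].  An alternating-path exchange argument shows that two
--     vertices missed by M₀ never have a common neighbour; hence the missed vertices
--     of degree ≤ k form a valid Ind, and at most one missed vertex has degree > k
--     (neighbourhoods of missed vertices are disjoint subsets of the 2k covered ones).
-- The theorem follows with W = V and k = h−1: if v(G) ≤ 2h−1 put everything in Q;
-- otherwise take S = Sep and for I a subset of Ind whose size makes |Q| + 2|S|
-- exactly 2h−1.

open import Defs
open import Data.Nat using (ℕ; _+_; _*_; _≤_; _<_; _⊓_; _∸_)
open import Data.Fin using (Fin)
open import Data.Bool using (true; _∧_)
open import Data.Product using (Σ; _×_)
open import Relation.Binary.PropositionalEquality using (_≡_)
open import Relation.Nullary using (¬_)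

open import Data.Nat using (zero; suc; z≤n; s≤s; _≤?_)
open import Data.Nat.Properties
  using (≤-refl; ≤-trans; ≤-reflexive; ≤-pred; <⇒≱; <⇒≤; ≰⇒>; n<1+n; +-mono-≤; +-mono-<;
         +-suc; +-comm; +-identityʳ; +-cancelʳ-≡; +-commutativeSemigroup;
         m≤n⇒m⊓n≡m; m≥n⇒m⊓n≡n; m≤n+o⇒m∸n≤o; m∸n+n≡m; m≤m+n; module ≤-Reasoning)
open import Data.Nat.Solver using (module +-*-Solver)
open import Data.Fin using (zero; suc; _≟_)
open import Data.Fin.Properties using (any?; suc-injective)
open import Algebra.Properties.CommutativeSemigroup +-commutativeSemigroup using (interchange)
open import Data.Bool using (Bool; false; _∨_; not; if_then_else_)
open import Data.Bool.Properties using (∧-zeroʳ) renaming (_≟_ to _≟ᵇ_)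
open import Data.Product using (_,_; proj₁; proj₂)
open import Data.Sum using (_⊎_; inj₁; inj₂; [_,_])
import Data.Sum as Sum
open import Data.List using (length; filter; tabulate)
open import Data.Vec using (Vec; []; _∷_; lookup)
open import Data.Unit using (⊤; tt)
open import Data.Empty using (⊥; ⊥-elim)
open import Function using (_∘_; id)
open import Relation.Binary.PropositionalEquality
  using (refl; sym; trans; cong; cong₂; subst; _≢_; module ≡-Reasoning)
open import Relation.Nullary using (Dec; yes; no; does)
open import Relation.Nullary.Decidable using (_×-dec_; ¬?; map′; dec-true; dec-false)

variable
  m k : ℕ

VSet : ℕ → Set
VSet m = Fin m → Bool

variable
  A A′ B B′ C D W X Y : VSet m
  a b c u₁ u₂ x y z : Fin m

infix  4 _∈_ _∉_ _⊆_ _∈?_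
infixl 7 _∩_
infixl 6 _∪_ _∖_ _─_

_∈_ _∉_ : Fin m → VSet m → Set
x ∈ A = A x ≡ true
x ∉ A = A x ≡ false

_∈?_ : (x : Fin m) (A : VSet m) → Dec (x ∈ A)
x ∈? A = A x ≟ᵇ true

_⊆_ : VSet m → VSet m → Set
A ⊆ B = ∀ x → x ∈ A → x ∈ B

∅ full : VSet m
∅ _ = false
full _ = true

∈∉-≢ : x ∈ A → y ∉ A → x ≢ y
∈∉-≢ x∈A y∉A refl with trans (sym x∈A) y∉A
... | ()

¬∈⇒∉ : ¬ (x ∈ A) → x ∉ A
¬∈⇒∉ {x = x} {A = A} x∉A with A x
... | false = refl
... | true = ⊥-elim (x∉A refl)

does-true : ∀ {P : Set} (d : Dec P) → does d ≡ true → P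
does-true (yes p) _ = p

does-false : ∀ {P : Set} (d : Dec P) → does d ≡ false → ¬ P
does-false (no ¬p) _ = ¬p

bit : Bool → ℕ
bit true = 1
bit false = 0

-- The set operations are kept abstract: they are used only through the
-- membership lemmas below, which keeps unification of set expressions syntactic.
abstract
  ⁅_⁆ : Fin m → VSet m
  ⁅ a ⁆ x = does (x ≟ a)

  _∪_ _∩_ _∖_ : VSet m → VSet m → VSet m
  (A ∪ B) x = A x ∨ B x
  (A ∩ B) x = A x ∧ B x
  (A ∖ B) x = A x ∧ not (B x)

  ∈⁅⁆ : (a : Fin m) → a ∈ ⁅ a ⁆
  ∈⁅⁆ a = dec-true (a ≟ a) refl

  ∉⁅⁆ : x ≢ a → x ∉ ⁅ a ⁆
  ∉⁅⁆ {x = x} {a = a} x≢a = dec-false (x ≟ a) x≢a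

  ∉⁅⁆⁻ : x ∉ ⁅ a ⁆ → x ≢ a
  ∉⁅⁆⁻ {x = x} {a = a} x∉ x≡a = ∈∉-≢ {A = ⁅ a ⁆} (∈⁅⁆ a) x∉ (sym x≡a)

  ∈⁅⁆⁻ : x ∈ ⁅ a ⁆ → x ≡ a
  ∈⁅⁆⁻ {x = x} {a = a} x∈ with x ≟ a | x∈
  ... | yes x≡a | _ = x≡a
  ... | no _ | ()

  ∈∪ˡ : x ∈ A → x ∈ A ∪ B
  ∈∪ˡ x∈A rewrite x∈A = refl

  ∈∪ʳ : x ∈ B → x ∈ A ∪ B
  ∈∪ʳ {x = x} {A = A} x∈B with A x
  ... | true = refl
  ... | false = x∈B

  ∈∪⁻ : x ∈ A ∪ B → x ∈ A ⊎ x ∈ B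
  ∈∪⁻ {x = x} {A = A} x∈ with A x
  ... | true = inj₁ refl
  ... | false = inj₂ x∈

  ∉∪ : x ∉ A → x ∉ B → x ∉ A ∪ B
  ∉∪ x∉A x∉B rewrite x∉A = x∉B

  ∉∪⁻ : x ∉ A ∪ B → x ∉ A × x ∉ B
  ∉∪⁻ {x = x} {A = A} x∉ with A x
  ... | false = refl , x∉

  ∈∩ : x ∈ A → x ∈ B → x ∈ A ∩ B
  ∈∩ x∈A x∈B rewrite x∈A = x∈B

  ∈∩⁻ : x ∈ A ∩ B → x ∈ A × x ∈ B
  ∈∩⁻ {x = x} {A = A} x∈ with A x
  ... | true = refl , x∈

  ∈∖ : x ∈ A → x ∉ B → x ∈ A ∖ B
  ∈∖ x∈A x∉B rewrite x∈A | x∉B = refl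

  ∈∖⁻ : x ∈ A ∖ B → x ∈ A × x ∉ B
  ∈∖⁻ {x = x} {A = A} {B = B} x∈ with A x | B x
  ... | true | false = refl , refl

  bits-∪∩ : ∀ x → bit (A x) + bit (B x) ≡ bit ((A ∪ B) x) + bit ((A ∩ B) x)
  bits-∪∩ {A = A} {B = B} x with A x | B x
  ... | true | true = refl
  ... | true | false = refl
  ... | false | true = refl
  ... | false | false = refl

_─_ : VSet m → Fin m → VSet m
A ─ a = A ∖ ⁅ a ⁆

∈─ : x ∈ A → x ≢ a → x ∈ A ─ a
∈─ x∈A x≢a = ∈∖ x∈A (∉⁅⁆ x≢a)

∈─⁻ : x ∈ A ─ a → x ∈ A × x ≢ a
∈─⁻ x∈ = let (x∈A , x∉a) = ∈∖⁻ x∈ in x∈A , ∉⁅⁆⁻ x∉a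

∉─ : a ∉ A ─ a
∉─ {a = a} {A = A} with (A ─ a) a in e
... | false = refl
... | true = ⊥-elim (proj₂ (∈─⁻ e) refl)

⊆-refl : A ⊆ A
⊆-refl _ x∈A = x∈A

⊆-trans : A ⊆ B → B ⊆ C → A ⊆ C
⊆-trans A⊆B B⊆C x = B⊆C x ∘ A⊆B x

⊆-∉ : A ⊆ B → x ∉ B → x ∉ A
⊆-∉ {A = A} {B = B} {x = x} A⊆B x∉B with A x in e
... | false = refl
... | true = ⊥-elim (∈∉-≢ {A = B} (A⊆B x e) x∉B refl)

∖⊆ : A ∖ B ⊆ A
∖⊆ x = proj₁ ∘ ∈∖⁻

∖-mono : A ⊆ A′ → B′ ⊆ B → A ∖ B ⊆ A′ ∖ B′
∖-mono A⊆A′ B′⊆B x x∈ = let (x∈A , x∉B) = ∈∖⁻ x∈ in ∈∖ (A⊆A′ x x∈A) (⊆-∉ B′⊆B x∉B)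

─-mono : A ⊆ A′ → A ─ a ⊆ A′ ─ a
─-mono A⊆A′ = ∖-mono A⊆A′ ⊆-refl

∖-comm : A ∖ B ∖ C ⊆ A ∖ C ∖ B
∖-comm x x∈ =
  let (x∈A∖B , x∉C) = ∈∖⁻ x∈ ; (x∈A , x∉B) = ∈∖⁻ x∈A∖B in ∈∖ (∈∖ x∈A x∉C) x∉B

∖─-∉ : x ∈ A ∖ B ─ a → x ∉ B
∖─-∉ = proj₂ ∘ ∈∖⁻ ∘ proj₁ ∘ ∈─⁻

──⊆ : A ─ a ─ b ⊆ A
──⊆ x = ∖⊆ x ∘ ∖⊆ x

──⊆∖pair : A ─ a ─ b ⊆ A ∖ (⁅ a ⁆ ∪ ⁅ b ⁆)
──⊆∖pair x x∈ =
  let (x∈A─a , x≢b) = ∈─⁻ x∈ ; (x∈A , x≢a) = ∈─⁻ x∈A─a in ∈∖ x∈A (∉∪ (∉⁅⁆ x≢a) (∉⁅⁆ x≢b))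

pair─ : a ≢ b → ∀ z → a ∈ ⁅ a ⁆ ∪ ⁅ b ⁆ ─ z ⊎ b ∈ ⁅ a ⁆ ∪ ⁅ b ⁆ ─ z
pair─ {a = a} {b = b} a≢b z with a ≟ z
... | yes refl = inj₂ (∈─ (∈∪ʳ (∈⁅⁆ b)) (a≢b ∘ sym))
... | no a≢z = inj₁ (∈─ (∈∪ˡ (∈⁅⁆ a)) a≢z)

∩─⊆ : A ∩ B ─ a ⊆ (A ─ a) ∩ B
∩─⊆ x x∈ = let (x∈A∩B , x≢a) = ∈─⁻ x∈ ; (x∈A , x∈B) = ∈∩⁻ x∈A∩B in ∈∩ (∈─ x∈A x≢a) x∈B

∖⊆─ : a ∈ B → A ∖ B ⊆ A ─ a
∖⊆─ {B = B} a∈B = ∖-mono ⊆-refl (λ x x∈a → subst (_∈ B) (sym (∈⁅⁆⁻ x∈a)) a∈B)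

─-rotate : A ─ a ─ b ─ x ⊆ A ─ x ─ a ─ b
─-rotate = ⊆-trans ∖-comm (─-mono ∖-comm)

∖-past-── : A ∖ B ─ a ─ b ⊆ A ─ a ─ b ∖ B
∖-past-── = ⊆-trans (─-mono ∖-comm) ∖-comm

──-past-∖ : A ─ a ─ b ∖ B ⊆ A ∖ B ─ a ─ b
──-past-∖ = ⊆-trans ∖-comm (─-mono ∖-comm)

-- Cardinality.  It is abstract, so that set expressions under card are compared
-- syntactically; its defining recursion is used only in this block.
abstract
  card : VSet m → ℕ
  card {zero} _ = 0
  card {suc m} A = bit (A zero) + card (A ∘ suc)

  card-cong : (∀ x → A x ≡ B x) → card A ≡ card B
  card-cong {zero} _ = refl
  card-cong {suc m} same = cong₂ _+_ (cong bit (same zero)) (card-cong (same ∘ suc))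

  card-mono : A ⊆ B → card A ≤ card B
  card-mono {zero} _ = z≤n
  card-mono {suc m} {A = A} {B = B} A⊆B =
    +-mono-≤ (bit-mono (A⊆B zero)) (card-mono (λ x → A⊆B (suc x)))
    where
    bit-mono : ∀ {p q} → (p ≡ true → q ≡ true) → bit p ≤ bit q
    bit-mono {false} _ = z≤n
    bit-mono {true} p⇒q rewrite p⇒q refl = ≤-refl

  card-∅ : (∀ x → x ∉ A) → card A ≡ 0
  card-∅ {zero} _ = refl
  card-∅ {suc m} {A = A} none rewrite none zero = card-∅ (λ x → none (suc x))

  card-full : card (full {m}) ≡ m
  card-full {zero} = refl
  card-full {suc m} = cong suc card-full

  card-additive : (∀ x → bit (A x) + bit (B x) ≡ bit (C x) + bit (D x)) →
                  card A + card B ≡ card C + card D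
  card-additive {zero} _ = refl
  card-additive {suc m} {A = A} {B = B} {C = C} {D = D} pointwise = begin
    (bit (A zero) + card (A ∘ suc)) + (bit (B zero) + card (B ∘ suc))
      ≡⟨ interchange (bit (A zero)) _ _ _ ⟩
    (bit (A zero) + bit (B zero)) + (card (A ∘ suc) + card (B ∘ suc))
      ≡⟨ cong₂ _+_ (pointwise zero) (card-additive (pointwise ∘ suc)) ⟩
    (bit (C zero) + bit (D zero)) + (card (C ∘ suc) + card (D ∘ suc))
      ≡⟨ interchange (bit (C zero)) _ _ _ ⟩
    (bit (C zero) + card (C ∘ suc)) + (bit (D zero) + card (D ∘ suc)) ∎
    where open ≡-Reasoning

  card-≤1 : (∀ x y → x ∈ A → y ∈ A → x ≡ y) → card A ≤ 1
  card-≤1 {zero} _ = z≤n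
  card-≤1 {suc m} {A = A} unique with A zero in e
  ... | true = ≤-reflexive (cong suc (card-∅ others))
    where
    others : ∀ x → A (suc x) ≡ false
    others x with A (suc x) in e′
    ... | false = refl
    ... | true with unique zero (suc x) e e′
    ...   | ()
  ... | false = card-≤1 (λ x y x∈ y∈ → suc-injective (unique (suc x) (suc y) x∈ y∈))

  card-parts : (f : Fin m → Part) →
    card (λ x → isPart (f x) S) + (card (λ x → isPart (f x) Q) + card (λ x → isPart (f x) I)) ≡ m
  card-parts {zero} f = refl
  card-parts {suc m} f with f zero | card-parts (f ∘ suc)
  ... | S | e = cong suc e
  ... | Q | e = trans (+-suc (card (λ x → isPart (f (suc x)) S)) _) (cong suc e)
  ... | I | e =
    let a = card (λ x → isPart (f (suc x)) S) ; b = card (λ x → isPart (f (suc x)) Q)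
        c = card (λ x → isPart (f (suc x)) I) in
    trans (cong (a +_) (+-suc b c)) (trans (+-suc a (b + c)) (cong suc e))

  card-choose : (t : ℕ) → t ≤ card A → Σ (VSet m) λ B → B ⊆ A × card B ≡ t
  card-choose {m} zero _ = ∅ , (λ _ ()) , card-∅ {A = ∅ {m}} (λ _ → refl)
  card-choose {suc m} {A = A} (suc t) t<card with A zero in e
  ... | true =
    let (B , B⊆A , cardB) = card-choose {A = A ∘ suc} t (≤-pred t<card) in
    (λ { zero → true ; (suc x) → B x }) , (λ { zero _ → e ; (suc x) → B⊆A x }) , cong suc cardB
  ... | false =
    let (B , B⊆A , cardB) = card-choose {A = A ∘ suc} (suc t) t<card in
    (λ { zero → false ; (suc x) → B x }) , (λ { zero () ; (suc x) → B⊆A x }) , cardB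

  count≡card : (A : VSet m) → count A ≡ card A
  count≡card A = filtered-length id
    where
    filtered-length : ∀ {n} (f : Fin n → Fin _) →
      length (filter (λ x → A x ≟ᵇ true) (tabulate f)) ≡ card (A ∘ f)
    filtered-length {zero} f = refl
    filtered-length {suc n} f with A (f zero)
    ... | true = cong suc (filtered-length (f ∘ suc))
    ... | false = filtered-length (f ∘ suc)

card-∪∩ : card A + card B ≡ card (A ∪ B) + card (A ∩ B)
card-∪∩ = card-additive bits-∪∩

card-∪ : card (A ∪ B) ≤ card A + card B
card-∪ {A = A} {B = B} = subst (card (A ∪ B) ≤_) (sym card-∪∩) (m≤m+n _ _)

card-disjoint-∪ : (∀ x → x ∉ A ∩ B) → card (A ∪ B) ≡ card A + card B
card-disjoint-∪ {A = A} {B = B} disjoint = begin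
  card (A ∪ B)                  ≡⟨ sym (+-identityʳ _) ⟩
  card (A ∪ B) + 0              ≡⟨ cong (card (A ∪ B) +_) (sym (card-∅ disjoint)) ⟩
  card (A ∪ B) + card (A ∩ B)   ≡⟨ sym card-∪∩ ⟩
  card A + card B               ∎
  where open ≡-Reasoning

card-⁅⁆ : card ⁅ a ⁆ ≤ 1
card-⁅⁆ = card-≤1 (λ x y x∈ y∈ → trans (∈⁅⁆⁻ x∈) (sym (∈⁅⁆⁻ y∈)))

card-─ : card A ≤ card (A ─ a) + 1
card-─ {A = A} {a = a} = ≤-trans (card-mono split) (≤-trans card-∪ (+-mono-≤ ≤-refl card-⁅⁆))
  where
  split : A ⊆ A ─ a ∪ ⁅ a ⁆
  split x x∈A with x ≟ a
  ... | yes refl = ∈∪ʳ (∈⁅⁆ a)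
  ... | no x≢a = ∈∪ˡ (∈─ x∈A x≢a)


module _ (G : Graph m) where

  adj-sym : Adj G x y → Adj G y x
  adj-sym {x = x} {y = y} xy = trans (symm G y x) xy

  adj-≢ : Adj G x y → x ≢ y
  adj-≢ {x = x} xy refl with trans (sym xy) (irrefl G x)
  ... | ()

  Edges : ℕ → Set
  Edges k = Vec (Fin m × Fin m) k

  IsMatchingIn : VSet m → Edges k → Set
  IsMatchingIn X [] = ⊤
  IsMatchingIn X ((u , v) ∷ M) = u ∈ X × v ∈ X × Adj G u v × IsMatchingIn (X ─ u ─ v) M

  MatchingIn : VSet m → ℕ → Set
  MatchingIn X k = Σ (Edges k) (IsMatchingIn X)

  covered : Edges k → VSet m
  covered [] = ∅
  covered ((u , v) ∷ M) = ⁅ u ⁆ ∪ ⁅ v ⁆ ∪ covered M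

  isMatchingIn-mono : X ⊆ Y → (M : Edges k) → IsMatchingIn X M → IsMatchingIn Y M
  isMatchingIn-mono X⊆Y [] _ = tt
  isMatchingIn-mono X⊆Y ((u , v) ∷ M) (u∈X , v∈X , uv , rest) =
    X⊆Y u u∈X , X⊆Y v v∈X , uv , isMatchingIn-mono (─-mono (─-mono X⊆Y)) M rest

  matchingIn-mono : X ⊆ Y → MatchingIn X k → MatchingIn Y k
  matchingIn-mono X⊆Y (M , m) = M , isMatchingIn-mono X⊆Y M m

  avoid : (M : Edges k) → IsMatchingIn X M → x ∉ covered M → IsMatchingIn (X ─ x) M
  avoid [] _ _ = tt
  avoid ((u , v) ∷ M) (u∈X , v∈X , uv , rest) x∉ =
    let (x∉uv , x∉M) = ∉∪⁻ x∉ ; (x∉u , x∉v) = ∉∪⁻ x∉uv in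
    ∈─ u∈X (∉⁅⁆⁻ x∉u ∘ sym) , ∈─ v∈X (∉⁅⁆⁻ x∉v ∘ sym) , uv ,
    isMatchingIn-mono ─-rotate M (avoid M rest x∉M)

  covered-size : (M : Edges k) → card (covered M) ≤ k + k
  covered-size [] = ≤-reflexive (card-∅ {A = ∅} λ _ → refl)
  covered-size {suc k} ((u , v) ∷ M) = begin
    card (⁅ u ⁆ ∪ ⁅ v ⁆ ∪ covered M)         ≤⟨ card-∪ ⟩
    card (⁅ u ⁆ ∪ ⁅ v ⁆) + card (covered M)  ≤⟨ +-mono-≤ (≤-trans card-∪ (+-mono-≤ card-⁅⁆ card-⁅⁆))
                                                          (covered-size M) ⟩
    2 + (k + k)                              ≡⟨ cong suc (sym (+-suc k k)) ⟩
    suc k + suc k                            ∎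
    where open ≤-Reasoning

  data Meets (X : VSet m) (v : Fin m) : ℕ → Set where
    avoids  : MatchingIn (X ─ v) k → Meets X v k
    matched : (c : Fin m) → Adj G v c → v ∈ X → c ∈ X → MatchingIn (X ─ v ─ c) k → Meets X v (suc k)

  meets : (M : Edges k) → IsMatchingIn X M → (v : Fin m) → Meets X v k
  meets [] _ v = avoids ([] , tt)
  meets ((u , w) ∷ M) (u∈X , w∈X , uw , rest) v with u ≟ v | w ≟ v
  ... | yes refl | _ = matched w uw u∈X w∈X (M , rest)
  ... | no _ | yes refl = matched u (adj-sym uw) w∈X u∈X (M , isMatchingIn-mono ∖-comm M rest)
  ... | no u≢v | no w≢v with meets M rest v
  ...   | avoids (M′ , m′) =
          avoids ((u , w) ∷ M′ , ∈─ u∈X u≢v , ∈─ w∈X w≢v , uw , isMatchingIn-mono ─-rotate M′ m′)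
  ...   | matched c vc v∈ c∈ (M₁ , m₁) =
          let c≢u = proj₂ (∈─⁻ (proj₁ (∈─⁻ c∈))) ; c≢w = proj₂ (∈─⁻ c∈) in
          matched c vc (──⊆ v v∈) (──⊆ c c∈)
            ((u , w) ∷ M₁ , ∈─ (∈─ u∈X u≢v) (c≢u ∘ sym) , ∈─ (∈─ w∈X w≢v) (c≢w ∘ sym) , uw ,
             isMatchingIn-mono (⊆-trans (─-mono ─-rotate) ─-rotate) M₁ m₁)

  matching? : ∀ k X → Dec (MatchingIn X k)
  matching? zero X = yes ([] , tt)
  matching? (suc k) X =
    map′ to from (any? λ u → any? λ v →
      (u ∈? X ×-dec v ∈? X ×-dec adj G u v ≟ᵇ true) ×-dec matching? k (X ─ u ─ v))
    where
    to : _ → MatchingIn X (suc k)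
    to (u , v , (u∈X , v∈X , uv) , M , m) = (u , v) ∷ M , u∈X , v∈X , uv , m
    from : MatchingIn X (suc k) → _
    from ((u , v) ∷ M , u∈X , v∈X , uv , m) = u , v , (u∈X , v∈X , uv) , M , m

  endpoint : Edges k → Fin k ⊎ Fin k → Fin m
  endpoint M = [ proj₁ ∘ lookup M , proj₂ ∘ lookup M ]

  endpoint∈ : (M : Edges k) → IsMatchingIn X M → ∀ s → endpoint M s ∈ X
  endpoint∈ ((u , v) ∷ M) (u∈X , _ , _ , _) (inj₁ zero) = u∈X
  endpoint∈ ((u , v) ∷ M) (_ , v∈X , _ , _) (inj₂ zero) = v∈X
  endpoint∈ ((u , v) ∷ M) (_ , _ , _ , rest) (inj₁ (suc i)) = ──⊆ _ (endpoint∈ M rest (inj₁ i))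
  endpoint∈ ((u , v) ∷ M) (_ , _ , _ , rest) (inj₂ (suc i)) = ──⊆ _ (endpoint∈ M rest (inj₂ i))

  endpoint-injective : (M : Edges k) → IsMatchingIn X M →
                       ∀ s t → endpoint M s ≡ endpoint M t → s ≡ t
  endpoint-injective [] _ (inj₁ ()) _ _
  endpoint-injective [] _ (inj₂ ()) _ _
  endpoint-injective {suc k} ((u , v) ∷ M) (_ , _ , uv , rest) = injective
    where
    fresh : ∀ s → endpoint M s ≢ u × endpoint M s ≢ v
    fresh s = let (e∈X─u , e≢v) = ∈─⁻ (endpoint∈ M rest s) in proj₂ (∈─⁻ e∈X─u) , e≢v
    shift : Fin k ⊎ Fin k → Fin (suc k) ⊎ Fin (suc k)
    shift = Sum.map suc suc
    tail : ∀ s t → endpoint M s ≡ endpoint M t → shift s ≡ shift t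
    tail s t e = cong shift (endpoint-injective M rest s t e)
    injective : ∀ s t → endpoint ((u , v) ∷ M) s ≡ endpoint ((u , v) ∷ M) t → s ≡ t
    injective (inj₁ zero) (inj₁ zero) _ = refl
    injective (inj₂ zero) (inj₂ zero) _ = refl
    injective (inj₁ zero) (inj₂ zero) e = ⊥-elim (adj-≢ uv e)
    injective (inj₂ zero) (inj₁ zero) e = ⊥-elim (adj-≢ uv (sym e))
    injective (inj₁ zero) (inj₁ (suc j)) e = ⊥-elim (proj₁ (fresh (inj₁ j)) (sym e))
    injective (inj₁ zero) (inj₂ (suc j)) e = ⊥-elim (proj₁ (fresh (inj₂ j)) (sym e))
    injective (inj₂ zero) (inj₁ (suc j)) e = ⊥-elim (proj₂ (fresh (inj₁ j)) (sym e))
    injective (inj₂ zero) (inj₂ (suc j)) e = ⊥-elim (proj₂ (fresh (inj₂ j)) (sym e))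
    injective (inj₁ (suc i)) (inj₁ zero) e = ⊥-elim (proj₁ (fresh (inj₁ i)) e)
    injective (inj₂ (suc i)) (inj₁ zero) e = ⊥-elim (proj₁ (fresh (inj₂ i)) e)
    injective (inj₁ (suc i)) (inj₂ zero) e = ⊥-elim (proj₂ (fresh (inj₁ i)) e)
    injective (inj₂ (suc i)) (inj₂ zero) e = ⊥-elim (proj₂ (fresh (inj₂ i)) e)
    injective (inj₁ (suc i)) (inj₁ (suc j)) e = tail (inj₁ i) (inj₁ j) e
    injective (inj₁ (suc i)) (inj₂ (suc j)) e = tail (inj₁ i) (inj₂ j) e
    injective (inj₂ (suc i)) (inj₁ (suc j)) e = tail (inj₂ i) (inj₁ j) e
    injective (inj₂ (suc i)) (inj₂ (suc j)) e = tail (inj₂ i) (inj₂ j) e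

  toMatching : MatchingIn X k → Matching G k
  toMatching (M , m) = record
    { left = proj₁ ∘ lookup M
    ; right = proj₂ ∘ lookup M
    ; isEdge = edges M m
    ; disjoint = λ {s} {t} → endpoint-injective M m s t
    }
    where
    edges : (M : Edges k) → IsMatchingIn X M → ∀ i → Adj G (proj₁ (lookup M i)) (proj₂ (lookup M i))
    edges ((u , v) ∷ M) (_ , _ , uv , _) zero = uv
    edges ((u , v) ∷ M) (_ , _ , _ , rest) (suc i) = edges M rest i

  -- Exchange along an alternating path.  Let M be a p-matching inside W avoiding T
  -- and a, and N a q-matching inside W.  Walk from a alternately along edges of N and
  -- of M.  If the walk stops after an N-edge, at some z, switching the walk gives a
  -- (p+1)-matching inside W that avoids T except possibly at z; if it stops at once
  -- or after an M-edge, switching gives a q-matching inside W avoiding a.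
  exchange : ∀ p {q} W T a → a ∉ T → MatchingIn (W ∖ T ─ a) p → MatchingIn W q →
             (Σ (Fin m) λ z → MatchingIn (W ∖ (T ─ z)) (suc p)) ⊎ MatchingIn (W ─ a) q
  exchange p W T a a∉T (M , m) (N , n) with meets N n a
  ... | avoids N′ = inj₂ N′
  ... | matched b ab a∈W b∈W (N₁ , n₁) with meets M m b
  ...   | avoids (M′ , m′) =
          inj₁ (b , (a , b) ∷ M′ , ∈∖ a∈W (⊆-∉ ∖⊆ a∉T) , ∈∖ b∈W ∉─ , ab ,
                isMatchingIn-mono (─-mono (─-mono (∖-mono ⊆-refl ∖⊆))) M′ m′)
  ...   | matched c bc b∈ c∈ (M₁ , m₁)
          with exchange _ (W ─ a ─ b) T c (∖─-∉ c∈)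
                 (M₁ , isMatchingIn-mono (─-mono ∖-past-──) M₁ m₁) (N₁ , n₁)
  ...     | inj₁ (z , M″ , m″) =
            inj₁ (z , (a , b) ∷ M″ , ∈∖ a∈W (⊆-∉ ∖⊆ a∉T) , ∈∖ b∈W (⊆-∉ ∖⊆ (∖─-∉ b∈)) ,
                  ab , isMatchingIn-mono ──-past-∖ M″ m″)
  ...     | inj₂ (N″ , n″) = inj₂ ((b , c) ∷ N″ , ─-mono ∖⊆ b b∈ , ─-mono ∖⊆ c c∈ , bc , n″)

  common-neighbour : (∀ v → v ∈ W → MatchingIn (W ─ v) k) → MatchingIn (W ─ u₁ ─ u₂) k →
                     u₁ ≢ u₂ → u₁ ∈ W → u₂ ∈ W → y ∈ W → Adj G y u₁ → Adj G y u₂ →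
                     MatchingIn W (suc k)
  common-neighbour {W = W} {u₁ = u₁} {u₂ = u₂} {y = y}
                   critical (M₀ , m₀) u₁≢u₂ u₁∈W u₂∈W y∈W yu₁ yu₂
    with meets M₀ (isMatchingIn-mono ──⊆∖pair M₀ m₀) y
  ... | avoids (M′ , m′) =
        (y , u₁) ∷ M′ , y∈W , u₁∈W , yu₁ ,
        isMatchingIn-mono (⊆-trans (─-mono (∖⊆─ (∈∪ˡ (∈⁅⁆ u₁)))) ∖-comm) M′ m′
  ... | matched x yx _ x∈ (M₁ , m₁)
        with exchange _ (W ─ y) (⁅ u₁ ⁆ ∪ ⁅ u₂ ⁆) x (proj₂ (∈∖⁻ x∈))
               (M₁ , isMatchingIn-mono (─-mono ∖-comm) M₁ m₁) (critical y y∈W)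
  ...   | inj₂ (N′ , n′) = (y , x) ∷ N′ , y∈W , proj₁ (∈∖⁻ x∈) , yx , n′
  ...   | inj₁ (z , M′ , m′) with pair─ u₁≢u₂ z
  ...     | inj₁ u₁∈ = (y , u₁) ∷ M′ , y∈W , u₁∈W , yu₁ , isMatchingIn-mono (∖⊆─ u₁∈) M′ m′
  ...     | inj₂ u₂∈ = (y , u₂) ∷ M′ , y∈W , u₂∈W , yu₂ , isMatchingIn-mono (∖⊆─ u₂∈) M′ m′

  record Barrier (k : ℕ) (W : VSet m) : Set where
    field
      Sep Ind         : VSet m
      Ind⊆W           : Ind ⊆ W
      Ind∩Sep         : ∀ x → x ∈ Ind → x ∉ Sep
      Ind-independent : ∀ x y → x ∈ Ind → y ∈ Ind → ¬ Adj G x y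
      one-neighbour   : ∀ y → y ∈ W → y ∉ Sep → card (adj G y ∩ Ind) ≤ 1
      low-degree      : ∀ x → x ∈ Ind → card (W ∩ adj G x) ≤ k
      balance         : card W + card Sep ≤ suc (k + k) + card Ind

  barrier-empty : (∀ x → x ∉ W) → Barrier k W
  barrier-empty {W = W} empty = record
    { Sep = ∅
    ; Ind = ∅
    ; Ind⊆W = λ _ ()
    ; Ind∩Sep = λ _ ()
    ; Ind-independent = λ _ _ ()
    ; one-neighbour = λ y y∈W _ → ⊥-elim (∈∉-≢ {A = W} y∈W (empty y) refl)
    ; low-degree = λ _ ()
    ; balance = ≤-trans (≤-reflexive (cong₂ _+_ (card-∅ empty) (card-∅ {A = ∅} λ _ → refl))) z≤n
    }

  barrier-delete : c ∈ W → Barrier k (W ─ c) → Barrier (suc k) W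
  barrier-delete {c = v} {W = W} {k = k} v∈W B = record
    { Sep = ⁅ v ⁆ ∪ Sep
    ; Ind = Ind
    ; Ind⊆W = ⊆-trans Ind⊆W ∖⊆
    ; Ind∩Sep = λ x x∈ → ∉∪ (∉⁅⁆ (proj₂ (∈─⁻ (Ind⊆W x x∈)))) (Ind∩Sep x x∈)
    ; Ind-independent = Ind-independent
    ; one-neighbour = λ y y∈W y∉ →
        let (y∉v , y∉Sep) = ∉∪⁻ y∉ in one-neighbour y (∈─ y∈W (∉⁅⁆⁻ y∉v)) y∉Sep
    ; low-degree = λ x x∈ → begin
        card (W ∩ adj G x)              ≤⟨ card-─ ⟩
        card (W ∩ adj G x ─ v) + 1      ≤⟨ +-mono-≤ (card-mono ∩─⊆) ≤-refl ⟩
        card ((W ─ v) ∩ adj G x) + 1    ≤⟨ +-mono-≤ (low-degree x x∈) ≤-refl ⟩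
        k + 1                           ≡⟨ +-comm k 1 ⟩
        suc k                           ∎
    ; balance = begin
        card W + card (⁅ v ⁆ ∪ Sep)
          ≤⟨ +-mono-≤ card-─ (≤-trans card-∪ (+-mono-≤ card-⁅⁆ ≤-refl)) ⟩
        (card (W ─ v) + 1) + (1 + card Sep)          ≡⟨ shuffle (card (W ─ v)) (card Sep) ⟩
        2 + (card (W ─ v) + card Sep)                ≤⟨ +-mono-≤ (≤-refl {2}) balance ⟩
        2 + (suc (k + k) + card Ind)                 ≡⟨ regroup k (card Ind) ⟩
        suc (suc k + suc k) + card Ind               ∎
    }
    where
    open Barrier B
    open ≤-Reasoning
    open +-*-Solver using (solve; _:+_; _:=_; con)
    shuffle : ∀ w s → (w + 1) + (1 + s) ≡ 2 + (w + s)
    shuffle = solve 2 (λ w s → (w :+ con 1) :+ (con 1 :+ s) := con 2 :+ (w :+ s)) refl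
    regroup : ∀ k i → 2 + (suc (k + k) + i) ≡ suc (suc k + suc k) + i
    regroup = solve 2 (λ k i → con 2 :+ ((con 1 :+ (k :+ k)) :+ i)
                             := (con 1 :+ ((con 1 :+ k) :+ (con 1 :+ k))) :+ i) refl

  module Critical {k W} (no-larger : ¬ MatchingIn W (suc k))
                  (critical : ∀ v → v ∈ W → MatchingIn (W ─ v) k)
                  (M₀ : Edges k) (m₀ : IsMatchingIn W M₀) where

    Missed : VSet m
    Missed = W ∖ covered M₀

    avoid-two : x ∈ Missed → y ∈ Missed → IsMatchingIn (W ─ x ─ y) M₀
    avoid-two x∈ y∈ = avoid M₀ (avoid M₀ m₀ (proj₂ (∈∖⁻ x∈))) (proj₂ (∈∖⁻ y∈))

    -- Missed vertices are pairwise non-adjacent: an edge between two of them would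
    -- extend M₀ to a (k+1)-matching.
    missed-independent : x ∈ Missed → y ∈ Missed → ¬ Adj G x y
    missed-independent x∈ y∈ xy =
      no-larger ((_ , _) ∷ M₀ , proj₁ (∈∖⁻ x∈) , proj₁ (∈∖⁻ y∈) , xy , avoid-two x∈ y∈)

    -- For the same reason every neighbour of a missed vertex is covered.
    neighbours-covered : x ∈ Missed → W ∩ adj G x ⊆ covered M₀
    neighbours-covered x∈ z z∈ with covered M₀ z in e
    ... | true = refl
    ... | false = let (z∈W , xz) = ∈∩⁻ z∈ in ⊥-elim (missed-independent x∈ (∈∖ z∈W e) xz)

    no-common-neighbour : x ≢ y → x ∈ Missed → y ∈ Missed → z ∈ W → Adj G z x → Adj G z y → ⊥
    no-common-neighbour x≢y x∈ y∈ z∈W zx zy =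
      no-larger (common-neighbour critical (M₀ , avoid-two x∈ y∈) x≢y
                                  (proj₁ (∈∖⁻ x∈)) (proj₁ (∈∖⁻ y∈)) z∈W zx zy)

    low : VSet m
    low x = does (card (W ∩ adj G x) ≤? k)

    Ind High : VSet m
    Ind = Missed ∩ low
    High = Missed ∖ low

    -- Two high missed vertices would have disjoint neighbourhoods of size > k
    -- inside the 2k vertices covered by M₀.
    high-unique : x ∈ High → y ∈ High → x ≡ y
    high-unique {x = x} {y = y} x∈ y∈ with x ≟ y
    ... | yes x≡y = x≡y
    ... | no x≢y = ⊥-elim (<⇒≱ (+-mono-< (n<1+n k) (n<1+n k)) (begin
          suc k + suc k                                    ≤⟨ +-mono-≤ (high x∈) (high y∈) ⟩
          card (W ∩ adj G x) + card (W ∩ adj G y)          ≡⟨ sym (card-disjoint-∪ disjoint) ⟩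
          card (W ∩ adj G x ∪ W ∩ adj G y)                 ≤⟨ card-mono covered-by-M₀ ⟩
          card (covered M₀)                                ≤⟨ covered-size M₀ ⟩
          k + k                                            ∎))
      where
      open ≤-Reasoning
      high : ∀ {w} → w ∈ High → suc k ≤ card (W ∩ adj G w)
      high {w} w∈ = ≰⇒> (does-false (card (W ∩ adj G w) ≤? k) (proj₂ (∈∖⁻ w∈)))
      disjoint : ∀ z → z ∉ W ∩ adj G x ∩ (W ∩ adj G y)
      disjoint z = ¬∈⇒∉ {A = W ∩ adj G x ∩ (W ∩ adj G y)} λ z∈ →
        let (zx , zy) = ∈∩⁻ z∈ ; (z∈W , xz) = ∈∩⁻ zx ; (_ , yz) = ∈∩⁻ zy in
        no-common-neighbour x≢y (proj₁ (∈∖⁻ x∈)) (proj₁ (∈∖⁻ y∈)) z∈W (adj-sym xz) (adj-sym yz)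
      covered-by-M₀ : W ∩ adj G x ∪ W ∩ adj G y ⊆ covered M₀
      covered-by-M₀ z z∈ with ∈∪⁻ z∈
      ... | inj₁ zx = neighbours-covered (proj₁ (∈∖⁻ x∈)) z zx
      ... | inj₂ zy = neighbours-covered (proj₁ (∈∖⁻ y∈)) z zy

    barrier-critical : Barrier k W
    barrier-critical = record
      { Sep = ∅
      ; Ind = Ind
      ; Ind⊆W = λ x x∈ → proj₁ (∈∖⁻ (missed x∈))
      ; Ind∩Sep = λ _ _ → refl
      ; Ind-independent = λ x y x∈ y∈ → missed-independent (missed x∈) (missed y∈)
      ; one-neighbour = λ y y∈W _ → card-≤1 (unique-neighbour y∈W)
      ; low-degree = λ x x∈ → does-true (card (W ∩ adj G x) ≤? k) (proj₂ (∈∩⁻ x∈))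
      ; balance = begin
          card W + card ∅           ≡⟨ cong (card W +_) (card-∅ {A = ∅} λ _ → refl) ⟩
          card W + 0                ≡⟨ +-identityʳ _ ⟩
          card W                    ≤⟨ W-size ⟩
          (k + k) + card Missed     ≤⟨ +-mono-≤ (≤-refl {k + k}) Missed-size ⟩
          (k + k) + (card Ind + 1)  ≡⟨ regroup k (card Ind) ⟩
          suc (k + k) + card Ind    ∎
      }
      where
      open ≤-Reasoning
      open +-*-Solver using (solve; _:+_; _:=_; con)
      missed : x ∈ Ind → x ∈ Missed
      missed = proj₁ ∘ ∈∩⁻
      unique-neighbour : y ∈ W → ∀ x₁ x₂ → x₁ ∈ adj G y ∩ Ind → x₂ ∈ adj G y ∩ Ind → x₁ ≡ x₂
      unique-neighbour y∈W x₁ x₂ x₁∈ x₂∈ with x₁ ≟ x₂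
      ... | yes x₁≡x₂ = x₁≡x₂
      ... | no x₁≢x₂ =
            let (yx₁ , x₁∈Ind) = ∈∩⁻ x₁∈ ; (yx₂ , x₂∈Ind) = ∈∩⁻ x₂∈ in
            ⊥-elim (no-common-neighbour x₁≢x₂ (missed x₁∈Ind) (missed x₂∈Ind) y∈W yx₁ yx₂)
      -- W consists of the ≤ 2k covered vertices and the missed ones.
      W-size : card W ≤ (k + k) + card Missed
      W-size = ≤-trans (card-mono split) (≤-trans card-∪ (+-mono-≤ (covered-size M₀) ≤-refl))
        where
        split : W ⊆ covered M₀ ∪ Missed
        split x x∈W with covered M₀ x in e
        ... | true = ∈∪ˡ e
        ... | false = ∈∪ʳ (∈∖ x∈W e)
      -- All missed vertices but at most one (the high one) are in Ind.
      Missed-size : card Missed ≤ card Ind + 1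
      Missed-size = ≤-trans (card-mono split)
                            (≤-trans card-∪ (+-mono-≤ ≤-refl (card-≤1 {A = High} λ _ _ → high-unique)))
        where
        split : Missed ⊆ Ind ∪ High
        split x x∈ with low x in e
        ... | true = ∈∪ˡ (∈∩ x∈ e)
        ... | false = ∈∪ʳ (∈∖ x∈ e)
      regroup : ∀ k i → (k + k) + (i + 1) ≡ suc (k + k) + i
      regroup = solve 2 (λ k i → (k :+ k) :+ (i :+ con 1) := (con 1 :+ (k :+ k)) :+ i) refl

  barrier : ∀ k W → ¬ MatchingIn W (suc k) → Barrier k W
  barrier k W no-larger with any? (λ v → v ∈? W ×-dec ¬? (matching? k (W ─ v)))
  barrier zero W no-larger | yes (v , _ , no-matching) = ⊥-elim (no-matching ([] , tt))
  barrier (suc k) W no-larger | yes (v , v∈W , no-matching) =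
    barrier-delete v∈W (barrier k (W ─ v) no-matching)
  barrier k W no-larger | no not-deletable with any? (_∈? W)
  ... | no empty = barrier-empty (λ x → ¬∈⇒∉ {A = W} (λ x∈W → empty (x , x∈W)))
  ... | yes (v , v∈W) =
        let (M₀ , m₀) = matchingIn-mono ∖⊆ (critical v v∈W) in
        Critical.barrier-critical no-larger critical M₀ m₀
    where
    critical : ∀ v → v ∈ W → MatchingIn (W ─ v) k
    critical v v∈W with matching? k (W ─ v)
    ... | yes M = M
    ... | no no-matching = ⊥-elim (not-deletable (v , v∈W , no-matching))

partition : VSet m → VSet m → Fin m → Part
partition A B x = if A x then S else if B x then I else Q

partition-S : ∀ x → isPart (partition A B x) S ≡ A x
partition-S {A = A} {B = B} x with A x | B x
... | true | _ = refl
... | false | true = refl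
... | false | false = refl

partition-I : (∀ x → x ∈ B → x ∉ A) → ∀ x → isPart (partition A B x) I ≡ B x
partition-I {B = B} {A = A} disjoint x with A x in eA | B x in eB
... | true | true = ⊥-elim (∈∉-≢ {A = A} eA (disjoint x eB) refl)
... | true | false = refl
... | false | true = refl
... | false | false = refl

-- Conditions (1)–(4) of the theorem for a partition `part`, where n = 2h.
IsGoodPartition : (h : ℕ) (G : Graph m) → (Fin m → Part) → Set
IsGoodPartition h G part =
  (count (λ x → isPart (part x) Q) + 2 * count (λ x → isPart (part x) S) ≡ v G ⊓ (2 * h ∸ 1))
  × (∀ x y → part x ≡ I → part y ≡ I → ¬ Adj G x y)
  × (v G ≤ 2 * h ∸ 1 → ∀ x → ¬ part x ≡ I)
  × (∀ x → part x ≡ Q → count (λ y → adj G x y ∧ isPart (part y) I) ≤ 1)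
  × (∀ x → part x ≡ I → deg G x < h)

all-in-Q : (h : ℕ) (G : Graph m) → m ≤ 2 * h ∸ 1 → IsGoodPartition h G (λ _ → Q)
all-in-Q {m} h G small = size , (λ _ _ ()) , (λ _ _ ()) , no-I-neighbour , (λ _ ())
  where
  open ≡-Reasoning
  size : count (full {m}) + 2 * count (∅ {m}) ≡ m ⊓ (2 * h ∸ 1)
  size = begin
    count (full {m}) + 2 * count (∅ {m})
      ≡⟨ cong₂ (λ q s → q + 2 * s) (trans (count≡card full) card-full)
                                   (trans (count≡card ∅) (card-∅ {A = ∅ {m}} λ _ → refl)) ⟩
    m + 0            ≡⟨ +-identityʳ m ⟩
    m                ≡⟨ sym (m≤n⇒m⊓n≡m small) ⟩
    m ⊓ (2 * h ∸ 1)  ∎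
  no-I-neighbour : ∀ x → Q ≡ Q → count (λ y → adj G x y ∧ false) ≤ 1
  no-I-neighbour x _ =
    ≤-trans (≤-reflexive (trans (count≡card _) (card-∅ λ y → ∧-zeroʳ (adj G x y)))) z≤n

odd : ∀ k → 2 * suc k ∸ 1 ≡ suc (k + k)
odd k = trans (+-suc k (k + 0)) (cong (λ t → suc (k + t)) (+-identityʳ k))

part-sizes : ∀ a c t s n → a + (c + t) ≡ n → t + s ≡ n + a → c + 2 * a ≡ s
part-sizes a c t s n total surplus = +-cancelʳ-≡ t (c + 2 * a) s (begin
  (c + 2 * a) + t      ≡⟨ regroup a c t ⟩
  (a + (c + t)) + a    ≡⟨ cong (_+ a) total ⟩
  n + a                ≡⟨ sym surplus ⟩
  t + s                ≡⟨ +-comm t s ⟩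
  s + t                ∎)
  where
  open ≡-Reasoning
  open +-*-Solver using (solve; _:+_; _:*_; _:=_; con)
  regroup : ∀ a c t → (c + 2 * a) + t ≡ (a + (c + t)) + a
  regroup = solve 3 (λ a c t → (c :+ con 2 :* a) :+ t := (a :+ (c :+ t)) :+ a) refl

-- If v(G) > 2k + 1, a barrier for (k, V) yields the partition: Sep becomes S, a subset
-- of Ind of size v(G) + |Sep| − (2k+1) becomes I, and the rest becomes Q.
from-barrier : (k : ℕ) (G : Graph m) → suc (k + k) < m → Barrier G k full →
               Σ (Fin m → Part) (IsGoodPartition (suc k) G)
from-barrier {m} k G large B =
  part , size , (λ x y px py → Ind-independent x y (in-Ind px) (in-Ind py)) ,
  (λ small → ⊥-elim (<⇒≱ large (subst (m ≤_) (odd k) small))) , one-I-neighbour , I-low-degree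
  where
  open Barrier B
  s surplus : ℕ
  s = suc (k + k)
  surplus = m + card Sep ∸ s
  surplus≤Ind : surplus ≤ card Ind
  surplus≤Ind =
    m≤n+o⇒m∸n≤o (m + card Sep) s (subst (λ n → n + card Sep ≤ s + card Ind) card-full balance)
  chosen : Σ (VSet m) λ B → B ⊆ Ind × card B ≡ surplus
  chosen = card-choose surplus surplus≤Ind
  I′ : VSet m
  I′ = proj₁ chosen
  I′⊆Ind : I′ ⊆ Ind
  I′⊆Ind = proj₁ (proj₂ chosen)
  I′∩Sep : ∀ x → x ∈ I′ → x ∉ Sep
  I′∩Sep x = Ind∩Sep x ∘ I′⊆Ind x
  part : Fin m → Part
  part = partition Sep I′
  is-S : ∀ x → isPart (part x) S ≡ Sep x
  is-S = partition-S {A = Sep} {B = I′}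
  is-I : ∀ x → isPart (part x) I ≡ I′ x
  is-I = partition-I {B = I′} {A = Sep} I′∩Sep
  in-Ind : ∀ {x} → part x ≡ I → x ∈ Ind
  in-Ind {x} px = I′⊆Ind x (trans (sym (is-I x)) (cong (λ p → isPart p I) px))

  cQ cI : ℕ
  cQ = card (λ x → isPart (part x) Q)
  cI = card (λ x → isPart (part x) I)
  all-parts : card Sep + (cQ + cI) ≡ m
  all-parts = subst (λ a → a + (cQ + cI) ≡ m) (card-cong is-S) (card-parts part)
  I-size : cI + s ≡ m + card Sep
  I-size = begin
    cI + s            ≡⟨ cong (_+ s) (trans (card-cong is-I) (proj₂ (proj₂ chosen))) ⟩
    surplus + s       ≡⟨ m∸n+n≡m (≤-trans (<⇒≤ large) (m≤m+n m (card Sep))) ⟩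
    m + card Sep      ∎
    where open ≡-Reasoning
  size : count (λ x → isPart (part x) Q) + 2 * count (λ x → isPart (part x) S) ≡ m ⊓ (2 * suc k ∸ 1)
  size = begin
    count (λ x → isPart (part x) Q) + 2 * count (λ x → isPart (part x) S)
      ≡⟨ cong₂ (λ q s → q + 2 * s) (count≡card _) (trans (count≡card _) (card-cong is-S)) ⟩
    cQ + 2 * card Sep
      ≡⟨ part-sizes (card Sep) cQ cI s m all-parts I-size ⟩
    s
      ≡⟨ sym (trans (m≥n⇒m⊓n≡n (subst (_≤ m) (sym (odd k)) (<⇒≤ large))) (odd k)) ⟩
    m ⊓ (2 * suc k ∸ 1) ∎
    where open ≡-Reasoning

  -- Condition (3): a vertex of Q is outside Sep, so it has at most one neighbour in Ind ⊇ I′.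
  one-I-neighbour : ∀ x → part x ≡ Q → count (λ y → adj G x y ∧ isPart (part y) I) ≤ 1
  one-I-neighbour x px = begin
    count (λ y → adj G x y ∧ isPart (part y) I)  ≡⟨ count≡card _ ⟩
    card (λ y → adj G x y ∧ isPart (part y) I)   ≤⟨ card-mono I-neighbour ⟩
    card (adj G x ∩ Ind)                         ≤⟨ one-neighbour x refl x∉Sep ⟩
    1                                            ∎
    where
    open ≤-Reasoning
    x∉Sep : x ∉ Sep
    x∉Sep = trans (sym (is-S x)) (cong (λ p → isPart p S) px)
    I-neighbour : (λ y → adj G x y ∧ isPart (part y) I) ⊆ adj G x ∩ Ind
    I-neighbour y _ with adj G x y in xy | isPart (part y) I in Iy
    ... | true | true = ∈∩ xy (I′⊆Ind y (trans (sym (is-I y)) Iy))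

  I-low-degree : ∀ x → part x ≡ I → deg G x < suc k
  I-low-degree x px = s≤s (begin
    deg G x              ≡⟨ count≡card (adj G x) ⟩
    card (adj G x)       ≤⟨ card-mono (λ y xy → ∈∩ refl xy) ⟩
    card (full ∩ adj G x) ≤⟨ low-degree x (in-Ind px) ⟩
    k                    ∎)
    where open ≤-Reasoning

lemma7 : (h : ℕ) → 1 ≤ h → (m : ℕ) → (G : Graph m) → Connected G → ¬ Matching G h →
    Σ (Fin m → Part) λ part →
    (count (λ x → isPart (part x) Q) + 2 * count (λ x → isPart (part x) S) ≡ v G ⊓ (2 * h ∸ 1))
    × (∀ x y → part x ≡ I → part y ≡ I → ¬ Adj G x y)
    × (v G ≤ 2 * h ∸ 1 → ∀ x → ¬ part x ≡ I)
    × (∀ x → part x ≡ Q → count (λ y → adj G x y ∧ isPart (part y) I) ≤ 1)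
    × (∀ x → part x ≡ I → deg G x < h)
lemma7 h _ m G _ _ with m ≤? 2 * h ∸ 1
... | yes small = (λ _ → Q) , all-in-Q h G small
lemma7 (suc k) (s≤s z≤n) m G _ no-matching | no large =
  from-barrier k G (subst (_< m) (odd k) (≰⇒> large))
               (barrier G k full (no-matching ∘ toMatching G))
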